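{- For all $n,k\ge0$, $$N_q(n,k)=s_{\langle 2^k\rangle}(q,q^2,\dots,q^{n-1}).$$
   Context: A Dyck path of length $2n$ is a word $w=a_1\cdots a_{2n}$ in letters $v,h$ with $n$ of each such that every prefix has at least as many $v$'s as $h$'s; $\mathcal{D}_n$ is the set of these. $\mathrm{des}(w)$ is the number of indices $i$ with $a_ia_{i+1}=hv$ and $\mathrm{MAJ}(w)$ is the sum of these indices $i$. The $q$-Narayana numbers are $N_q(n,k)=\sum_{w\in\mathcal{D}_n,\ \mathrm{des}(w)=k}q^{\mathrm{MAJ}(w)}$. $\langle2^k\rangle$ is the partition $(2,\dots,2)$ with $k$ parts, and $s_\lambda$ is the Schur function, $s_\lambda(x)=\sum_T x^T$ over semistandard Young tableaux $T$ of shape $\lambda$, where $x^T=\prod_i x_i^{\#\{\text{entries of }T\text{ equal to } i\}}$. -}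

module Defs where

open import Level using (Level)
open import Data.Nat using (ℕ; zero; suc; _+_; _<ᵇ_; _≤ᵇ_; _≡ᵇ_; _∸_)
open import Data.Bool using (Bool; true; false; _∧_)
open import Data.Nat.ListAction using (sum)
open import Data.List using (List; []; _∷_; length; filter; concatMap; map; foldr; replicate)
open import Data.Fin using (Fin; toℕ)
open import Data.Vec using (Vec; lookup; tabulate)
open import Data.Vec as V using ()
open import Data.List.Base using (allFin)
open import Algebra.Bundles using (CommutativeSemiring)
open import Relation.Nullary.Decidable using (yes; no)
open import Relation.Binary.PropositionalEquality using (_≡_)
open import Data.Bool.Properties using () renaming (_≟_ to _≟ᵇ_)

data Step : Set where
  v h : Step

words : ℕ → List (List Step)
words zero = [] ∷ []
words (suc m) = concatMap (λ w → (v ∷ w) ∷ (h ∷ w) ∷ []) (words m)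

dyckFrom : ℕ → List Step → Bool
dyckFrom d [] = d ≡ᵇ 0
dyckFrom d (v ∷ w) = dyckFrom (suc d) w
dyckFrom zero (h ∷ w) = false
dyckFrom (suc d) (h ∷ w) = dyckFrom d w

isDyck : List Step → Bool
isDyck = dyckFrom 0

D : ℕ → List (List Step)
D n = filter (λ w → isDyck w ≟ᵇ true) (words (n + n))

-- descentsFrom i w : the (1-based) indices j with a_j a_{j+1} = h v,
-- where the first letter of w has index i
descentsFrom : ℕ → List Step → List ℕ
descentsFrom i [] = []
descentsFrom i (h ∷ v ∷ w) = i ∷ descentsFrom (suc i) (v ∷ w)
descentsFrom i (_ ∷ w) = descentsFrom (suc i) w

descents : List Step → List ℕ
descents = descentsFrom 1

des : List Step → ℕ
des w = length (descents w)

MAJ : List Step → ℕ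
MAJ w = sum (descents w)

-- Tableaux: a filling of a shape λ = (λ₁, λ₂, …) (list of row lengths)
-- is a list of rows, row i having λ_i entries from Fin m (entry j
-- standing for the value j+1 ∈ {1,…,m}).

fillRow : ∀ m → ℕ → List (List (Fin m))
fillRow m zero = [] ∷ []
fillRow m (suc r) = concatMap (λ a → map (a ∷_) (fillRow m r)) (allFin m)

fillings : ∀ m → List ℕ → List (List (List (Fin m)))
fillings m [] = [] ∷ []
fillings m (r ∷ λs) = concatMap (λ row → map (row ∷_) (fillings m λs)) (fillRow m r)

rowWeak : ∀ {m} → List (Fin m) → Bool
rowWeak [] = true
rowWeak (a ∷ []) = true
rowWeak (a ∷ b ∷ r) = (toℕ a ≤ᵇ toℕ b) ∧ rowWeak (b ∷ r)

colStrict : ∀ {m} → List (Fin m) → List (Fin m) → Bool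
colStrict (a ∷ r) (b ∷ s) = (toℕ a <ᵇ toℕ b) ∧ colStrict r s
colStrict _ _ = true

isSSYT : ∀ {m} → List (List (Fin m)) → Bool
isSSYT [] = true
isSSYT (r ∷ []) = rowWeak r
isSSYT (r ∷ s ∷ t) = rowWeak r ∧ colStrict r s ∧ isSSYT (s ∷ t)

SSYT : ∀ m → List ℕ → List (List (List (Fin m)))
SSYT m λs = filter (λ T → isSSYT T ≟ᵇ true) (fillings m λs)

twos : ℕ → List ℕ
twos k = replicate k 2

module _ {c ℓ : Level} (R : CommutativeSemiring c ℓ) where
  open CommutativeSemiring R renaming (_+_ to _⊕_; _*_ to _⊗_)

  pow : Carrier → ℕ → Carrier
  pow x zero = 1#
  pow x (suc n) = x ⊗ pow x n

  Σ : List Carrier → Carrier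
  Σ = foldr _⊕_ 0#

  Π : List Carrier → Carrier
  Π = foldr _⊗_ 1#

  Nq : Carrier → ℕ → ℕ → Carrier
  Nq q n k = Σ (map (λ w → pow q (MAJ w)) (filter (λ w → des w Data.Nat.≟ k) (D n)))

  monomial : ∀ {m} → Vec Carrier m → List (List (Fin m)) → Carrier
  monomial x T = Π (map (λ row → Π (map (lookup x) row)) T)

  schur : ∀ {m} → Vec Carrier m → List ℕ → Carrier
  schur {m} x λs = Σ (map (monomial x) (SSYT m λs))

  qVars : Carrier → (n : ℕ) → Vec Carrier (n ∸ 1)
  qVars q n = tabulate (λ i → pow q (suc (toℕ i)))

module Submission where

-- A Dyck path with k descents is determined by its valleys: the j-th one follows y_j h's and
-- x_j v's, lies at descent index x_j + y_j, and 1 ≤ y_j ≤ x_j ≤ n-1 with both (y_j) and (x_j)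
-- strictly increasing. Taking (y_j, x_j) as the j-th row, these are exactly the semistandard
-- tableaux of shape ⟨2^k⟩ with entries in {1,…,n-1}, and q^MAJ is the monomial q^Σ(x_j+y_j).
-- Both sides are computed by recursions, over the letters of the path and over the rows of the
-- tableau, whose states are then matched.

open import Defs
open import Level using (Level)
open import Algebra.Bundles using (CommutativeSemiring)
open import Data.Bool using (Bool; true; false; T; _∧_; if_then_else_)
open import Data.Bool.Properties using (∧-identityʳ) renaming (_≟_ to _≟ᵇ_)
open import Data.Fin using (Fin; toℕ) renaming (suc to fsuc)
open import Data.List using (List; []; _∷_; _++_; map; concatMap; filter; length; allFin; tabulate)
open import Data.List.Properties using (map-tabulate)
open import Data.Nat using (ℕ; zero; suc; _+_; _∸_; _<_; _≤ᵇ_; _<ᵇ_; _≡ᵇ_; _≤?_; z≤n; s≤s)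
open import Data.Nat.ListAction using (sum)
open import Data.Nat.Tactic.RingSolver using (solve-∀)
import Data.Nat.Properties as ℕₚ
open import Data.Vec as Vec using (Vec)
open import Data.Vec.Properties using (lookup∘tabulate)
open import Relation.Nullary using (¬_; yes; no; contradiction)
open import Relation.Nullary.Decidable using (does)
open import Relation.Unary using (Pred; Decidable)
open import Relation.Binary.PropositionalEquality as ≡ using (_≡_)

module Sums {c ℓ : Level} (R : CommutativeSemiring c ℓ) where
  open CommutativeSemiring R renaming (_+_ to _⊕_; _*_ to _⊗_)
  open import Algebra.Properties.CommutativeSemigroup +-commutativeSemigroup using (interchange)
  open import Relation.Binary.Reasoning.Setoid setoid

  when : Bool → Carrier → Carrier
  when b x = if b then x else 0#

  when-cong : ∀ b {x y} → x ≈ y → when b x ≈ when b y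
  when-cong true  x≈y = x≈y
  when-cong false _   = refl

  when-0# : ∀ b → when b 0# ≈ 0#
  when-0# true  = refl
  when-0# false = refl

  *-when : ∀ b x y → x ⊗ when b y ≈ when b (x ⊗ y)
  *-when true  x y = refl
  *-when false x y = zeroʳ x

  when-T : ∀ {b} x → T b → when b x ≈ x
  when-T {true} x _ = refl

  when-¬T : ∀ {b} x → ¬ T b → when b x ≈ 0#
  when-¬T {true}  x ¬t = contradiction _ ¬t
  when-¬T {false} x _  = refl

  when-comm : ∀ a b x → when a (when b x) ≈ when b (when a x)
  when-comm true  true  x = refl
  when-comm true  false x = refl
  when-comm false true  x = refl
  when-comm false false x = refl

  pow-+ : ∀ x m n → pow R x (m + n) ≈ pow R x m ⊗ pow R x n
  pow-+ x zero    n = sym (*-identityˡ _)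
  pow-+ x (suc m) n = trans (*-congˡ (pow-+ x m n)) (sym (*-assoc _ _ _))

  ∑ : {A : Set} → List A → (A → Carrier) → Carrier
  ∑ xs f = Σ R (map f xs)

  syntax ∑ xs (λ x → e) = ∑[ x ∈ xs ] e

  ∑-cong : ∀ {A : Set} (xs : List A) {f g : A → Carrier} → (∀ x → f x ≈ g x) → ∑ xs f ≈ ∑ xs g
  ∑-cong []       f≈g = refl
  ∑-cong (x ∷ xs) f≈g = +-cong (f≈g x) (∑-cong xs f≈g)

  ∑-++ : ∀ {A : Set} (xs ys : List A) (f : A → Carrier) → ∑ (xs ++ ys) f ≈ ∑ xs f ⊕ ∑ ys f
  ∑-++ []       ys f = sym (+-identityˡ _)
  ∑-++ (x ∷ xs) ys f = trans (+-congˡ (∑-++ xs ys f)) (sym (+-assoc _ _ _))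

  ∑-map : ∀ {A B : Set} (g : A → B) (xs : List A) (f : B → Carrier) → ∑ (map g xs) f ≡ ∑ xs (λ x → f (g x))
  ∑-map g []       f = ≡.refl
  ∑-map g (x ∷ xs) f = ≡.cong (f (g x) ⊕_) (∑-map g xs f)

  ∑-concatMap : ∀ {A B : Set} (g : A → List B) (xs : List A) (f : B → Carrier) →
    ∑ (concatMap g xs) f ≈ ∑[ x ∈ xs ] ∑ (g x) f
  ∑-concatMap g []       f = refl
  ∑-concatMap g (x ∷ xs) f = trans (∑-++ (g x) _ f) (+-congˡ (∑-concatMap g xs f))

  ∑-+ : ∀ {A : Set} (xs : List A) (f g : A → Carrier) → ∑[ x ∈ xs ] (f x ⊕ g x) ≈ ∑ xs f ⊕ ∑ xs g
  ∑-+ []       f g = sym (+-identityˡ _)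
  ∑-+ (x ∷ xs) f g = trans (+-congˡ (∑-+ xs f g)) (interchange _ _ _ _)

  *-∑ : ∀ {A : Set} (xs : List A) (a : Carrier) (f : A → Carrier) → ∑[ x ∈ xs ] (a ⊗ f x) ≈ a ⊗ ∑ xs f
  *-∑ []       a f = sym (zeroʳ a)
  *-∑ (x ∷ xs) a f = trans (+-congˡ (*-∑ xs a f)) (sym (distribˡ _ _ _))

  ∑-0# : ∀ {A : Set} (xs : List A) → ∑[ x ∈ xs ] 0# ≈ 0#
  ∑-0# []       = refl
  ∑-0# (x ∷ xs) = trans (+-identityˡ _) (∑-0# xs)

  ∑-when : ∀ {A : Set} (xs : List A) (b : Bool) (f : A → Carrier) → ∑[ x ∈ xs ] when b (f x) ≈ when b (∑ xs f)
  ∑-when xs true  f = refl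
  ∑-when xs false f = ∑-0# xs

  ∑-comm : ∀ {A B : Set} (xs : List A) (ys : List B) (f : A → B → Carrier) →
    ∑[ x ∈ xs ] ∑ ys (f x) ≈ ∑[ y ∈ ys ] ∑[ x ∈ xs ] f x y
  ∑-comm []       ys f = sym (∑-0# ys)
  ∑-comm (x ∷ xs) ys f = trans (+-congˡ (∑-comm xs ys f)) (sym (∑-+ ys (f x) _))

  ∑-filter : ∀ {A : Set} {p} {P : Pred A p} (P? : Decidable P) (xs : List A) (f : A → Carrier) →
    ∑ (filter P? xs) f ≈ ∑[ x ∈ xs ] when (does (P? x)) (f x)
  ∑-filter P? []       f = refl
  ∑-filter P? (x ∷ xs) f with does (P? x)
  ... | true  = +-congˡ (∑-filter P? xs f)
  ... | false = trans (∑-filter P? xs f) (sym (+-identityˡ _))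

  sumFrom : ℕ → ℕ → (ℕ → Carrier) → Carrier
  sumFrom s zero    f = 0#
  sumFrom s (suc n) f = f s ⊕ sumFrom (suc s) n f

  sumFrom-cong : ∀ s n {f g : ℕ → Carrier} → (∀ x → x < s + n → f x ≈ g x) → sumFrom s n f ≈ sumFrom s n g
  sumFrom-cong s zero    f≈g = refl
  sumFrom-cong s (suc n) f≈g =
    +-cong (f≈g s (ℕₚ.m<m+n s (s≤s z≤n)))
           (sumFrom-cong (suc s) n (λ x x<1+s+n → f≈g x (≡.subst (x <_) (≡.sym (ℕₚ.+-suc s n)) x<1+s+n)))

  sumFrom-suc : ∀ s n (f : ℕ → Carrier) → sumFrom (suc s) n f ≡ sumFrom s n (λ x → f (suc x))
  sumFrom-suc s zero    f = ≡.refl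
  sumFrom-suc s (suc n) f = ≡.cong (f (suc s) ⊕_) (sumFrom-suc (suc s) n f)

  ∑-allFin : ∀ N (g : ℕ → Carrier) → ∑[ a ∈ allFin N ] g (toℕ a) ≈ sumFrom 0 N g
  ∑-allFin zero    g = refl
  ∑-allFin (suc N) g = +-congˡ (begin
    ∑[ a ∈ tabulate {n = N} fsuc ] g (toℕ a)  ≡⟨ ≡.cong (λ as → ∑[ a ∈ as ] g (toℕ a)) (map-tabulate {n = N} (λ a → a) fsuc) ⟨
    ∑[ a ∈ map fsuc (allFin N) ] g (toℕ a)    ≡⟨ ∑-map fsuc (allFin N) (λ a → g (toℕ a)) ⟩
    ∑[ a ∈ allFin N ] g (suc (toℕ a))         ≈⟨ ∑-allFin N (λ x → g (suc x)) ⟩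
    sumFrom 0 N (λ x → g (suc x))             ≡⟨ sumFrom-suc 0 N g ⟨
    sumFrom 1 N g                             ∎)

  suc≤ᵇsuc : ∀ t x → (suc t ≤ᵇ suc x) ≡ (t ≤ᵇ x)
  suc≤ᵇsuc zero    x = ≡.refl
  suc≤ᵇsuc (suc t) x = ≡.refl

  sumFrom-≥ : ∀ t n (f : ℕ → Carrier) → sumFrom 0 n (λ x → when (t ≤ᵇ x) (f x)) ≈ sumFrom t (n ∸ t) f
  sumFrom-≥ zero    n       f = refl
  sumFrom-≥ (suc t) zero    f = refl
  sumFrom-≥ (suc t) (suc n) f = begin
    0# ⊕ sumFrom 1 n (λ x → when (suc t ≤ᵇ x) (f x))        ≈⟨ +-identityˡ _ ⟩
    sumFrom 1 n (λ x → when (suc t ≤ᵇ x) (f x))             ≡⟨ sumFrom-suc 0 n _ ⟩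
    sumFrom 0 n (λ x → when (suc t ≤ᵇ suc x) (f (suc x)))
      ≈⟨ sumFrom-cong 0 n (λ x _ → reflexive (≡.cong (λ b → when b (f (suc x))) (suc≤ᵇsuc t x))) ⟩
    sumFrom 0 n (λ x → when (t ≤ᵇ x) (f (suc x)))           ≈⟨ sumFrom-≥ t n (λ x → f (suc x)) ⟩
    sumFrom t (n ∸ t) (λ x → f (suc x))                     ≡⟨ sumFrom-suc t (n ∸ t) f ⟨
    sumFrom (suc t) (n ∸ t) f                               ∎

  sumFrom-≤ : ∀ {b} s n (f : ℕ → Carrier) → b < s + n →
    sumFrom s n (λ x → when (x ≤ᵇ b) (f x)) ≈ sumFrom s (suc b ∸ s) f
  sumFrom-≤ {b} s zero f b<s+0 =
    reflexive (≡.cong (λ m → sumFrom s m f) (≡.sym (ℕₚ.m≤n⇒m∸n≡0 (≡.subst (b <_) (ℕₚ.+-identityʳ s) b<s+0))))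
  sumFrom-≤ {b} s (suc n) f b<s+1+n with IH ← sumFrom-≤ (suc s) n f (≡.subst (b <_) (ℕₚ.+-suc s n) b<s+1+n) | s ≤? b
  ... | yes s≤b = begin
    when (s ≤ᵇ b) (f s) ⊕ _          ≈⟨ +-cong (when-T (f s) (ℕₚ.≤⇒≤ᵇ s≤b)) IH ⟩
    f s ⊕ sumFrom (suc s) (b ∸ s) f  ≡⟨ ≡.cong (λ m → sumFrom s m f) (ℕₚ.+-∸-assoc 1 s≤b) ⟨
    sumFrom s (suc b ∸ s) f          ∎
  ... | no s≰b = begin
    when (s ≤ᵇ b) (f s) ⊕ _          ≈⟨ +-cong (when-¬T (f s) (λ t → s≰b (ℕₚ.≤ᵇ⇒≤ s b t))) IH ⟩
    0# ⊕ sumFrom (suc s) (b ∸ s) f   ≈⟨ +-identityˡ _ ⟩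
    sumFrom (suc s) (b ∸ s) f        ≡⟨ ≡.cong (λ m → sumFrom (suc s) m f) (ℕₚ.m≤n⇒m∸n≡0 (ℕₚ.<⇒≤ b<s)) ⟩
    0#                               ≡⟨ ≡.cong (λ m → sumFrom s m f) (ℕₚ.m≤n⇒m∸n≡0 b<s) ⟨
    sumFrom s (suc b ∸ s) f          ∎
    where b<s = ℕₚ.≰⇒> s≰b

  ∑-ordered-pairs : ∀ N la lb (H : ℕ → ℕ → Carrier) →
    ∑[ a ∈ allFin N ] ∑[ b ∈ allFin N ]
      when (la ≤ᵇ toℕ a) (when (lb ≤ᵇ toℕ b) (when (toℕ a ≤ᵇ toℕ b) (H (toℕ a) (toℕ b))))
    ≈ sumFrom lb (N ∸ lb) (λ b → sumFrom la (suc b ∸ la) (λ a → H a b))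
  ∑-ordered-pairs N la lb H = begin
    ∑[ a ∈ allFin N ] ∑[ b ∈ allFin N ] W a b  ≈⟨ ∑-comm (allFin N) (allFin N) W ⟩
    ∑[ b ∈ allFin N ] ∑[ a ∈ allFin N ] W a b
      ≈⟨ ∑-cong (allFin N) (λ b → trans (∑-cong (allFin N) (λ a → when-comm (la ≤ᵇ toℕ a) (lb ≤ᵇ toℕ b) _))
                                 (trans (∑-when (allFin N) (lb ≤ᵇ toℕ b) _) (when-cong _ (∑-allFin N _)))) ⟩
    ∑[ b ∈ allFin N ] when (lb ≤ᵇ toℕ b) (inner (toℕ b))  ≈⟨ ∑-allFin N _ ⟩
    sumFrom 0 N (λ b → when (lb ≤ᵇ b) (inner b))
      ≈⟨ sumFrom-cong 0 N (λ b b<N → when-cong _ (trans (sumFrom-≥ la N _)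
                              (sumFrom-≤ la (N ∸ la) _ (ℕₚ.<-≤-trans b<N (ℕₚ.m≤n+m∸n N la))))) ⟩
    sumFrom 0 N (λ b → when (lb ≤ᵇ b) (sumFrom la (suc b ∸ la) (λ a → H a b)))  ≈⟨ sumFrom-≥ lb N _ ⟩
    sumFrom lb (N ∸ lb) (λ b → sumFrom la (suc b ∸ la) (λ a → H a b))  ∎
    where
    W : Fin N → Fin N → Carrier
    W a b = when (la ≤ᵇ toℕ a) (when (lb ≤ᵇ toℕ b) (when (toℕ a ≤ᵇ toℕ b) (H (toℕ a) (toℕ b))))
    inner : ℕ → Carrier
    inner b = sumFrom 0 N (λ a → when (la ≤ᵇ a) (when (a ≤ᵇ b) (H a b)))

does-≟-true : ∀ b → does (b ≟ᵇ true) ≡ b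
does-≟-true true  = ≡.refl
does-≟-true false = ≡.refl

module Paths {c ℓ : Level} (R : CommutativeSemiring c ℓ) (q : CommutativeSemiring.Carrier R) where
  open CommutativeSemiring R renaming (_+_ to _⊕_; _*_ to _⊗_)
  open Sums R
  open import Relation.Binary.Reasoning.Setoid setoid

  weight : ℕ → ℕ → ℕ → List Step → Carrier
  weight d i k w = when (dyckFrom d w) (when (length (descentsFrom i w) ≡ᵇ k) (pow R q (sum (descentsFrom i w))))

  -- Generating functions of the suffixes of length m, read from excess d with the next letter at
  -- index i and k descents still to come. Right after an h (pathsAfterH, readVAfterH), i is
  -- instead the index of that h, since a v read next closes a descent at i.
  paths       : ℕ → ℕ → ℕ → ℕ → Carrier
  pathsAfterH : ℕ → ℕ → ℕ → ℕ → Carrier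
  readH       : ℕ → ℕ → ℕ → ℕ → Carrier
  readVAfterH : ℕ → ℕ → ℕ → ℕ → Carrier

  paths zero    d i k = when (d ≡ᵇ 0) (when (0 ≡ᵇ k) 1#)
  paths (suc m) d i k = readH m d i k ⊕ paths m (suc d) (suc i) k

  pathsAfterH zero    d i k = when (d ≡ᵇ 0) (when (0 ≡ᵇ k) 1#)
  pathsAfterH (suc m) d i k = readVAfterH m d i k ⊕ readH m d (suc i) k

  readH m zero    i k = 0#
  readH m (suc d) i k = pathsAfterH m d i k

  readVAfterH m d i zero    = 0#
  readVAfterH m d i (suc k) = pow R q i ⊗ paths m (suc d) (suc (suc i)) k

  ∑-words-suc : ∀ m (f : List Step → Carrier) →
    ∑ (words (suc m)) f ≈ ∑[ w ∈ words m ] f (v ∷ w) ⊕ ∑[ w ∈ words m ] f (h ∷ w)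
  ∑-words-suc m f = begin
    ∑ (words (suc m)) f                                  ≈⟨ ∑-concatMap _ (words m) f ⟩
    ∑[ w ∈ words m ] (f (v ∷ w) ⊕ (f (h ∷ w) ⊕ 0#))      ≈⟨ ∑-cong (words m) (λ w → +-congˡ (+-identityʳ _)) ⟩
    ∑[ w ∈ words m ] (f (v ∷ w) ⊕ f (h ∷ w))             ≈⟨ ∑-+ (words m) _ _ ⟩
    ∑[ w ∈ words m ] f (v ∷ w) ⊕ ∑[ w ∈ words m ] f (h ∷ w)  ∎

  weight-valley : ∀ d i k w → weight (suc d) i (suc k) (h ∷ v ∷ w) ≈ pow R q i ⊗ weight (suc d) (suc (suc i)) k w
  weight-valley d i k w = begin
    when A (when B (pow R q (i + s)))           ≈⟨ when-cong A (when-cong B (pow-+ q i s)) ⟩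
    when A (when B (pow R q i ⊗ pow R q s))     ≈⟨ when-cong A (*-when B _ _) ⟨
    when A (pow R q i ⊗ when B (pow R q s))     ≈⟨ *-when A _ _ ⟨
    pow R q i ⊗ when A (when B (pow R q s))     ∎
    where
    A = dyckFrom (suc d) w
    B = length (descentsFrom (suc (suc i)) w) ≡ᵇ k
    s = sum (descentsFrom (suc (suc i)) w)

  paths-spec       : ∀ m d i k → ∑ (words m) (weight d i k) ≈ paths m d i k
  pathsAfterH-spec : ∀ m d i k → ∑[ w ∈ words m ] weight (suc d) i k (h ∷ w) ≈ pathsAfterH m d i k
  readH-spec       : ∀ m d i k → ∑[ w ∈ words m ] weight d i k (h ∷ w) ≈ readH m d i k
  readVAfterH-spec : ∀ m d i k → ∑[ w ∈ words m ] weight (suc d) i k (h ∷ v ∷ w) ≈ readVAfterH m d i k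

  paths-spec zero    d i k = +-identityʳ _
  paths-spec (suc m) d i k =
    trans (∑-words-suc m _) (trans (+-comm _ _) (+-cong (readH-spec m d i k) (paths-spec m (suc d) (suc i) k)))

  pathsAfterH-spec zero    d i k = +-identityʳ _
  pathsAfterH-spec (suc m) d i k =
    trans (∑-words-suc m _) (+-cong (readVAfterH-spec m d i k) (readH-spec m d (suc i) k))

  readH-spec m zero    i k = ∑-0# (words m)
  readH-spec m (suc d) i k = pathsAfterH-spec m d i k

  readVAfterH-spec m d i zero    = trans (∑-cong (words m) (λ w → when-0# (dyckFrom (suc d) w))) (∑-0# (words m))
  readVAfterH-spec m d i (suc k) = begin
    ∑[ w ∈ words m ] weight (suc d) i (suc k) (h ∷ v ∷ w)     ≈⟨ ∑-cong (words m) (weight-valley d i k) ⟩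
    ∑[ w ∈ words m ] (pow R q i ⊗ weight (suc d) (suc (suc i)) k w)  ≈⟨ *-∑ (words m) _ _ ⟩
    pow R q i ⊗ ∑ (words m) (weight (suc d) (suc (suc i)) k)   ≈⟨ *-congˡ (paths-spec m (suc d) (suc (suc i)) k) ⟩
    pow R q i ⊗ paths m (suc d) (suc (suc i)) k               ∎

  Nq≈paths : ∀ n k → Nq R q n k ≈ paths (n + n) 0 1 k
  Nq≈paths n k = begin
    Nq R q n k                                               ≈⟨ ∑-filter _ (D n) _ ⟩
    ∑[ w ∈ D n ] when (des w ≡ᵇ k) (pow R q (MAJ w))          ≈⟨ ∑-filter _ (words (n + n)) _ ⟩
    ∑[ w ∈ words (n + n) ] when (does (isDyck w ≟ᵇ true)) (when (des w ≡ᵇ k) (pow R q (MAJ w)))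
      ≈⟨ ∑-cong (words (n + n)) (λ w → reflexive
           (≡.cong (λ b → when b (when (des w ≡ᵇ k) (pow R q (MAJ w)))) (does-≟-true (isDyck w)))) ⟩
    ∑ (words (n + n)) (weight 0 1 k)                         ≈⟨ paths-spec (n + n) 0 1 k ⟩
    paths (n + n) 0 1 k                                      ∎

module Tableaux {c ℓ : Level} (R : CommutativeSemiring c ℓ) (q : CommutativeSemiring.Carrier R) (N : ℕ) where
  open CommutativeSemiring R renaming (_+_ to _⊕_; _*_ to _⊗_)
  open Sums R
  open import Relation.Binary.Reasoning.Setoid setoid

  x : Vec Carrier N
  x = Vec.tabulate (λ a → pow R q (suc (toℕ a)))

  atLeast : List ℕ → List (Fin N) → Bool
  atLeast (l ∷ ls) (a ∷ r) = (l ≤ᵇ toℕ a) ∧ atLeast ls r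
  atLeast _        _       = true

  firstRowAtLeast : List ℕ → List (List (Fin N)) → Bool
  firstRowAtLeast ls []      = true
  firstRowAtLeast ls (r ∷ T) = atLeast ls r

  firstRowAtLeast-0 : ∀ T → firstRowAtLeast (0 ∷ 0 ∷ []) T ≡ true
  firstRowAtLeast-0 []                  = ≡.refl
  firstRowAtLeast-0 ([] ∷ T)            = ≡.refl
  firstRowAtLeast-0 ((a ∷ []) ∷ T)      = ≡.refl
  firstRowAtLeast-0 ((a ∷ b ∷ r) ∷ T)   = ≡.refl

  colStrict≡atLeast : ∀ r s → colStrict r s ≡ atLeast (map (λ a → suc (toℕ a)) r) s
  colStrict≡atLeast []      s       = ≡.refl
  colStrict≡atLeast (a ∷ r) []      = ≡.refl
  colStrict≡atLeast (a ∷ r) (b ∷ s) = ≡.cong ((toℕ a <ᵇ toℕ b) ∧_) (colStrict≡atLeast r s)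

  isSSYT-∷ : ∀ r T → isSSYT (r ∷ T) ≡ rowWeak r ∧ (firstRowAtLeast (map (λ a → suc (toℕ a)) r) T ∧ isSSYT T)
  isSSYT-∷ r []      = ≡.sym (∧-identityʳ (rowWeak r))
  isSSYT-∷ r (s ∷ T) = ≡.cong (λ b → rowWeak r ∧ (b ∧ isSSYT (s ∷ T))) (colStrict≡atLeast r s)

  schurAtLeast : ℕ → ℕ → ℕ → Carrier
  schurAtLeast k la lb =
    ∑[ T ∈ fillings N (twos k) ] when (firstRowAtLeast (la ∷ lb ∷ []) T ∧ isSSYT T) (monomial R x T)

  tableaux : ℕ → ℕ → ℕ → Carrier
  tableaux zero    la lb = 1#
  tableaux (suc k) la lb = sumFrom lb (N ∸ lb) (λ b → sumFrom la (suc b ∸ la) (λ a →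
    (pow R q (suc a) ⊗ pow R q (suc b)) ⊗ tableaux k (suc a) (suc b)))

  schur≈schurAtLeast : ∀ k → schur R x (twos k) ≈ schurAtLeast k 0 0
  schur≈schurAtLeast k = trans (∑-filter _ (fillings N (twos k)) _)
    (∑-cong (fillings N (twos k)) (λ T → reflexive (≡.cong (λ b → when b (monomial R x T))
      (≡.trans (does-≟-true (isSSYT T)) (≡.cong (_∧ isSSYT T) (≡.sym (firstRowAtLeast-0 T)))))))

  ∑-fillRow-suc : ∀ r (g : List (Fin N) → Carrier) →
    ∑ (fillRow N (suc r)) g ≈ ∑[ a ∈ allFin N ] ∑[ row ∈ fillRow N r ] g (a ∷ row)
  ∑-fillRow-suc r g = trans (∑-concatMap _ (allFin N) g)
    (∑-cong (allFin N) (λ a → reflexive (∑-map (a ∷_) (fillRow N r) g)))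

  ∑-fillings-suc : ∀ k (F : List (List (Fin N)) → Carrier) →
    ∑ (fillings N (twos (suc k))) F ≈ ∑[ a ∈ allFin N ] ∑[ b ∈ allFin N ] ∑[ T ∈ fillings N (twos k) ] F ((a ∷ b ∷ []) ∷ T)
  ∑-fillings-suc k F = begin
    ∑ (fillings N (twos (suc k))) F                       ≈⟨ ∑-concatMap _ (fillRow N 2) F ⟩
    ∑[ row ∈ fillRow N 2 ] ∑ (map (row ∷_) (fillings N (twos k))) F
      ≈⟨ ∑-cong (fillRow N 2) (λ row → reflexive (∑-map (row ∷_) (fillings N (twos k)) F)) ⟩
    ∑[ row ∈ fillRow N 2 ] G row                          ≈⟨ ∑-fillRow-suc 1 G ⟩
    ∑[ a ∈ allFin N ] ∑[ row ∈ fillRow N 1 ] G (a ∷ row)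
      ≈⟨ ∑-cong (allFin N) (λ a → trans (∑-fillRow-suc 0 _) (∑-cong (allFin N) (λ b → +-identityʳ _))) ⟩
    ∑[ a ∈ allFin N ] ∑[ b ∈ allFin N ] G (a ∷ b ∷ [])    ∎
    where
    G : List (Fin N) → Carrier
    G row = ∑[ T ∈ fillings N (twos k) ] F (row ∷ T)

  row-monomial : ∀ a b → Π R (map (Vec.lookup x) (a ∷ b ∷ [])) ≈ pow R q (suc (toℕ a)) ⊗ pow R q (suc (toℕ b))
  row-monomial a b rewrite lookup∘tabulate (λ a → pow R q (suc (toℕ a))) a
                         | lookup∘tabulate (λ a → pow R q (suc (toℕ a))) b = *-congˡ (*-identityʳ _)

  when-split : ∀ A B C D u y → when ((A ∧ (B ∧ true)) ∧ ((C ∧ true) ∧ D)) (u ⊗ y) ≈ when A (when B (when C (u ⊗ when D y)))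
  when-split true  true  true  true  u y = refl
  when-split true  true  true  false u y = sym (zeroʳ u)
  when-split true  true  false D     u y = refl
  when-split true  false C     D     u y = refl
  when-split false B     C     D     u y = refl

  schurAtLeast≈tableaux : ∀ k la lb → schurAtLeast k la lb ≈ tableaux k la lb
  schurAtLeast≈tableaux zero    la lb = +-identityʳ 1#
  schurAtLeast≈tableaux (suc k) la lb = begin
    schurAtLeast (suc k) la lb   ≈⟨ ∑-fillings-suc k _ ⟩
    ∑[ a ∈ allFin N ] ∑[ b ∈ allFin N ] ∑[ T ∈ fillings N (twos k) ] summand a b T
      ≈⟨ ∑-cong (allFin N) (λ a → ∑-cong (allFin N) (λ b → first-row a b)) ⟩
    ∑[ a ∈ allFin N ] ∑[ b ∈ allFin N ]
      when (la ≤ᵇ toℕ a) (when (lb ≤ᵇ toℕ b) (when (toℕ a ≤ᵇ toℕ b) (H (toℕ a) (toℕ b))))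
      ≈⟨ ∑-ordered-pairs N la lb H ⟩
    tableaux (suc k) la lb       ∎
    where
    summand : Fin N → Fin N → List (List (Fin N)) → Carrier
    summand a b T = when (firstRowAtLeast (la ∷ lb ∷ []) ((a ∷ b ∷ []) ∷ T) ∧ isSSYT ((a ∷ b ∷ []) ∷ T))
                         (monomial R x ((a ∷ b ∷ []) ∷ T))
    H : ℕ → ℕ → Carrier
    H a b = (pow R q (suc a) ⊗ pow R q (suc b)) ⊗ tableaux k (suc a) (suc b)
    first-row : ∀ a b → ∑[ T ∈ fillings N (twos k) ] summand a b T ≈
      when (la ≤ᵇ toℕ a) (when (lb ≤ᵇ toℕ b) (when (toℕ a ≤ᵇ toℕ b) (H (toℕ a) (toℕ b))))
    first-row a b = begin
      ∑[ T ∈ Ts ] summand a b T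
        ≈⟨ ∑-cong Ts (λ T → trans (reflexive (≡.cong (λ s → when ((LA ∧ (LB ∧ true)) ∧ s) (u ⊗ monomial R x T))
                                                        (isSSYT-∷ (a ∷ b ∷ []) T)))
                                  (when-split LA LB AB _ u _)) ⟩
      ∑[ T ∈ Ts ] when LA (when LB (when AB (u ⊗ rest T)))
        ≈⟨ trans (∑-when Ts LA _) (when-cong LA (trans (∑-when Ts LB _) (when-cong LB (trans (∑-when Ts AB _)
             (when-cong AB (*-∑ Ts u rest)))))) ⟩
      when LA (when LB (when AB (u ⊗ schurAtLeast k (suc (toℕ a)) (suc (toℕ b)))))
        ≈⟨ when-cong LA (when-cong LB (when-cong AB (*-cong (row-monomial a b) (schurAtLeast≈tableaux k _ _)))) ⟩
      when LA (when LB (when AB (H (toℕ a) (toℕ b))))  ∎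
      where
      Ts = fillings N (twos k)
      LA = la ≤ᵇ toℕ a
      LB = lb ≤ᵇ toℕ b
      AB = toℕ a ≤ᵇ toℕ b
      u = Π R (map (Vec.lookup x) (a ∷ b ∷ []))
      rest : List (List (Fin N)) → Carrier
      rest T = when (firstRowAtLeast (suc (toℕ a) ∷ suc (toℕ b) ∷ []) T ∧ isSSYT T) (monomial R x T)

module Correspondence {c ℓ : Level} (R : CommutativeSemiring c ℓ) (q : CommutativeSemiring.Carrier R) (N : ℕ) where
  open CommutativeSemiring R renaming (_+_ to _⊕_; _*_ to _⊗_)
  open Sums R
  open Paths R q
  open Tableaux R q N
  open import Relation.Binary.Reasoning.Setoid setoid

  0#⊕0# : ∀ {x y} → x ≈ 0# → y ≈ 0# → x ⊕ y ≈ 0#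
  0#⊕0# x≈0 y≈0 = trans (+-cong x≈0 y≈0) (+-identityˡ 0#)

  paths-short       : ∀ {m d} i k → m < d → paths m d i k ≈ 0#
  pathsAfterH-short : ∀ {m d} i k → m < d → pathsAfterH m d i k ≈ 0#

  paths-short {zero}  {suc d}       i k _ = refl
  paths-short {suc m} {suc (suc d)} i k (s≤s m<1+d) =
    0#⊕0# (pathsAfterH-short i k m<1+d) (paths-short (suc i) k (ℕₚ.m<n⇒m<1+n (ℕₚ.m<n⇒m<1+n m<1+d)))

  pathsAfterH-short {zero}  {suc d}       i k _ = refl
  pathsAfterH-short {suc m} {suc (suc d)} i zero    (s≤s m<1+d) = 0#⊕0# refl (pathsAfterH-short (suc i) 0 m<1+d)
  pathsAfterH-short {suc m} {suc (suc d)} i (suc k) (s≤s m<1+d) =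
    0#⊕0# (trans (*-congˡ (paths-short (suc (suc i)) k (ℕₚ.m<n⇒m<1+n (ℕₚ.m<n⇒m<1+n m<1+d)))) (zeroʳ _))
          (pathsAfterH-short (suc i) (suc k) m<1+d)

  pathsAfterH-onlyH : ∀ d i k → pathsAfterH d d i k ≈ when (0 ≡ᵇ k) 1#
  pathsAfterH-onlyH zero    i k = refl
  pathsAfterH-onlyH (suc d) i k = trans (+-congʳ (readVAfterH-short k)) (trans (+-identityˡ _) (pathsAfterH-onlyH d (suc i) k))
    where
    readVAfterH-short : ∀ k → readVAfterH d (suc d) i k ≈ 0#
    readVAfterH-short zero    = refl
    readVAfterH-short (suc k) = trans (*-congˡ (paths-short (suc (suc i)) k (ℕₚ.m<n⇒m<1+n (ℕₚ.n<1+n d)))) (zeroʳ _)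

  paths-onlyH : ∀ d i k → paths d d i k ≈ when (0 ≡ᵇ k) 1#
  paths-onlyH zero    i k = refl
  paths-onlyH (suc d) i k =
    trans (+-cong (pathsAfterH-onlyH d i k) (paths-short (suc i) k (ℕₚ.m<n⇒m<1+n (ℕₚ.n<1+n d)))) (+-identityʳ _)

  pathsAfterH-noValley : ∀ d e i → pathsAfterH (d + suc e) d i 0 ≈ 0#
  pathsAfterH-noValley zero    e i = +-identityˡ 0#
  pathsAfterH-noValley (suc d) e i = trans (+-identityˡ _) (pathsAfterH-noValley d e (suc i))

  length-afterV : ∀ r d → r + suc (r + d) ≡ r + (r + suc d)
  length-afterV r d = ≡.cong (r +_) (≡.sym (ℕₚ.+-suc r d))

  paths-length : ∀ {m m'} d i k → m ≡ m' → paths m d i k ≈ paths m' d i k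
  paths-length d i k m≡m' = reflexive (≡.cong (λ m → paths m d i k) m≡m')

  paths-noValley : ∀ r d i → paths (r + (r + d)) d i 0 ≈ 1#
  paths-noValley zero    d       i = paths-onlyH d i 0
  paths-noValley (suc r) d       i = trans (+-cong (readH-long d)
    (trans (paths-length (suc d) (suc i) 0 (length-afterV r d)) (paths-noValley r (suc d) (suc i)))) (+-identityˡ 1#)
    where
    readH-long : ∀ d → readH (r + suc (r + d)) d i 0 ≈ 0#
    readH-long zero    = refl
    readH-long (suc d) = trans (reflexive (≡.cong (λ m → pathsAfterH m d i 0) (rearrange r d))) (pathsAfterH-noValley d (suc (r + r)) i)
      where
      rearrange : ∀ r d → r + suc (r + suc d) ≡ d + suc (suc (r + r))
      rearrange = solve-∀

  valleyWeight : ℕ → ℕ → ℕ → Carrier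
  valleyWeight k b a = (pow R q (suc a) ⊗ pow R q (suc b)) ⊗ tableaux k (suc a) (suc b)

  -- A row (a, b) of a tableau is a valley of the path: after a+1 h's and b+1 v's, i.e. a descent
  -- at index a+b+2, of weight q^(a+1) q^(b+1). So tableaux k la lb counts the completions of a
  -- prefix with la h's and lb+1 v's that ends in v, has excess d and leaves r more v's to read.
  TableauxAsPaths : ℕ → Set ℓ
  TableauxAsPaths k = ∀ r d la lb i → la + d ≡ suc lb → i ≡ suc (suc (la + lb)) → lb + r ≡ N →
    tableaux k la lb ≈ paths (r + (r + d)) d i k

  module NextRow (k : ℕ) (ih : TableauxAsPaths k) where

    valley : ∀ d la lb i r → la + suc d ≡ suc lb → i ≡ suc (suc (la + lb)) → lb + suc r ≡ N →
      valleyWeight k lb la ≈ pow R q i ⊗ paths (r + suc (r + d)) (suc d) (suc (suc i)) k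
    valley d la lb i r la+1+d≡1+lb i≡ lb+1+r≡N = *-cong
      (trans (sym (pow-+ q (suc la) (suc lb)))
             (reflexive (≡.cong (pow R q) (≡.trans (≡.cong suc (ℕₚ.+-suc la lb)) (≡.sym i≡)))))
      (trans (ih r (suc d) (suc la) (suc lb) (suc (suc i)) (≡.cong suc la+1+d≡1+lb)
                 (≡.trans (≡.cong (λ j → suc (suc j)) i≡) (≡.cong (λ j → suc (suc (suc j))) (≡.sym (ℕₚ.+-suc la lb))))
                 (≡.trans (≡.sym (ℕₚ.+-suc lb r)) lb+1+r≡N))
             (paths-length (suc d) (suc (suc i)) k (≡.sym (length-afterV r d))))

    lastColumn : ∀ d la lb i r → la + d ≡ suc lb → i ≡ suc (suc (la + lb)) → lb + suc r ≡ N →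
      sumFrom la d (valleyWeight k lb) ≈ readH (r + suc (r + d)) d i (suc k)
    lastColumn zero    la lb i r _ _ _ = refl
    lastColumn (suc d) la lb i r la+1+d≡1+lb i≡ lb+1+r≡N = begin
      valleyWeight k lb la ⊕ sumFrom (suc la) d (valleyWeight k lb)
        ≈⟨ +-cong (valley d la lb i r la+1+d≡1+lb i≡ lb+1+r≡N)
                  (lastColumn d (suc la) lb (suc i) r (≡.trans (≡.sym (ℕₚ.+-suc la d)) la+1+d≡1+lb) (≡.cong suc i≡) lb+1+r≡N) ⟩
      pathsAfterH (suc (r + suc (r + d))) d i (suc k)
        ≡⟨ ≡.cong (λ m → pathsAfterH m d i (suc k)) (≡.trans (ℕₚ.+-suc r (r + suc d)) (≡.cong suc (≡.sym (length-afterV r d)))) ⟨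
      readH (r + suc (r + suc d)) (suc d) i (suc k) ∎

    rows : ∀ r d la lb i → la + d ≡ suc lb → i ≡ suc (suc (la + lb)) → lb + r ≡ N →
      sumFrom lb r (λ b → sumFrom la (suc b ∸ la) (valleyWeight k b)) ≈ paths (r + (r + d)) d i (suc k)
    rows zero    d la lb i _ _ _ = sym (paths-onlyH d i (suc k))
    rows (suc r) d la lb i la+d≡1+lb i≡ lb+1+r≡N = +-cong
      (trans (reflexive (≡.cong (λ n → sumFrom la n (valleyWeight k lb))
                                (≡.trans (≡.cong (_∸ la) (≡.sym la+d≡1+lb)) (ℕₚ.m+n∸m≡n la d))))
             (lastColumn d la lb i r la+d≡1+lb i≡ lb+1+r≡N))
      (trans (rows r (suc d) la (suc lb) (suc i) (≡.trans (ℕₚ.+-suc la d) (≡.cong suc la+d≡1+lb))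
                   (≡.trans (≡.cong suc i≡) (≡.cong (λ j → suc (suc j)) (≡.sym (ℕₚ.+-suc la lb))))
                   (≡.trans (≡.sym (ℕₚ.+-suc lb r)) lb+1+r≡N))
             (paths-length (suc d) (suc i) (suc k) (≡.sym (length-afterV r d))))

  tableaux≈paths : ∀ k → TableauxAsPaths k
  tableaux≈paths zero    r d la lb i _ _ _ = sym (paths-noValley r d i)
  tableaux≈paths (suc k) r d la lb i la+d≡1+lb i≡ lb+r≡N = trans
    (reflexive (≡.cong (λ n → sumFrom lb n _) (≡.trans (≡.cong (_∸ lb) (≡.sym lb+r≡N)) (ℕₚ.m+n∸m≡n lb r))))
    (NextRow.rows k (tableaux≈paths k) r d la lb i la+d≡1+lb i≡ lb+r≡N)

module _ {c ℓ : Level} (R : CommutativeSemiring c ℓ) (q : CommutativeSemiring.Carrier R) where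
  open CommutativeSemiring R using (_≈_; refl; sym; trans; +-identityˡ)
  open Paths R q

  paths≈tableaux : ∀ n k → paths (n + n) 0 1 k ≈ Tableaux.tableaux R q (n ∸ 1) k 0 0
  paths≈tableaux zero    zero    = refl
  paths≈tableaux zero    (suc k) = refl
  paths≈tableaux (suc N) k = trans (+-identityˡ _)
    (trans (Correspondence.paths-length R q N 1 2 k (≡.cong (N +_) (ℕₚ.+-comm 1 N)))
           (sym (Correspondence.tableaux≈paths R q N k N 1 0 0 2 ≡.refl ≡.refl ≡.refl)))

theorem2p5 : ∀ {c ℓ} (R : CommutativeSemiring c ℓ) (q : CommutativeSemiring.Carrier R) (n k : ℕ) →
    CommutativeSemiring._≈_ R (Nq R q n k) (schur R (qVars R q n) (twos k))
theorem2p5 R q n k = begin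
  Nq R q n k                      ≈⟨ Nq≈paths n k ⟩
  paths (n + n) 0 1 k             ≈⟨ paths≈tableaux R q n k ⟩
  tableaux k 0 0                  ≈⟨ schurAtLeast≈tableaux k 0 0 ⟨
  schurAtLeast k 0 0              ≈⟨ schur≈schurAtLeast k ⟨
  schur R (qVars R q n) (twos k)  ∎
  where
  open CommutativeSemiring R using (setoid)
  open import Relation.Binary.Reasoning.Setoid setoid
  open Paths R q
  open Tableaux R q (n ∸ 1)
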